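{- Let $P$ be a polytope in $\mathbb{Q}^V$ and let $\sigma:V\to[k]$ be an index map. Then $P^\sigma=\{z\in\mathbb{Q}^k : z^{ -\sigma}\in P \text{ or all separating hyperplanes at } z^{ -\sigma} \text{ disagree with } \sigma\}$.
   Context: $V$ is a finite set and $[k]=\{0,\dots,k-1\}$. An index map is an onto map $\sigma:V\to[k]$ with $k\le|V|$. Let $V_i=\sigma^{ -1}(i)$. For $x\in\mathbb{Q}^V$, the folded vector $x^\sigma\in\mathbb{Q}^k$ has $(x^\sigma)_i=\frac1{|V_i|}\sum_{v\in V_i}x_v$, and $P^\sigma=\{x^\sigma:x\in P\}$. For $z\in\mathbb{Q}^k$, the unfolded vector $z^{ -\sigma}\in\mathbb{Q}^V$ has $(z^{ -\sigma})_v=z_{\sigma(v)}$. A vector $c\in\mathbb{Q}^V$ agrees with $\sigma$ if $\sigma(v)=\sigma(v')$ implies $c_v=c_{v'}$. For a point $x\in\mathbb{Q}^V$, all separating hyperplanes at $x$ disagree with $\sigma$ if there is no $c\in\mathbb{Q}^V$ that both agrees with $\sigma$ and satisfies $c^\top x>\max\{c^\top y: y\in P\}$. A polytope in $\mathbb{Q}^V$ is an intersection of finitely many rational half-spaces. -}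

module Defs where

open import Data.Nat using (ℕ; zero; suc)
open import Data.Fin using (Fin; zero; suc; _≟_)
open import Data.Integer using (+_)
open import Data.Rational using (ℚ; 0ℚ; 1ℚ; _+_; _*_; _/_; _≤_; _<_)
open import Data.Product using (Σ; ∃; _×_)
open import Data.Empty using (⊥)
open import Relation.Nullary using (¬_; yes; no)
open import Relation.Binary.PropositionalEquality using (_≡_)

-- V = Fin n ; vectors in ℚ^V are functions Fin n → ℚ.

sumFin : (n : ℕ) → (Fin n → ℚ) → ℚ
sumFin zero    f = 0ℚ
sumFin (suc n) f = f zero + sumFin n (λ v → f (suc v))

dot : {n : ℕ} → (Fin n → ℚ) → (Fin n → ℚ) → ℚ
dot {n} c x = sumFin n (λ v → c v * x v)

IsIndexMap : (n k : ℕ) → (Fin n → Fin k) → Set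
IsIndexMap n k σ = (k Data.Nat.≤ n) × ((i : Fin k) → ∃ λ v → σ v ≡ i)

-- |V_i| as a rational number's reciprocal (1/0 := 0, never used for onto σ)
inv : ℕ → ℚ
inv zero    = 0ℚ
inv (suc m) = + 1 / suc m

card : {n k : ℕ} → (Fin n → Fin k) → Fin k → ℕ
card {zero}  σ i = zero
card {suc n} σ i with σ zero ≟ i
... | yes _ = suc (card (λ v → σ (suc v)) i)
... | no  _ = card (λ v → σ (suc v)) i

fold : {n k : ℕ} → (Fin n → Fin k) → (Fin n → ℚ) → Fin k → ℚ
fold {n} σ x i = inv (card σ i) * sumFin n (λ v → sel (σ v ≟ i) (x v))
  where
  sel : {A : Set} → Relation.Nullary.Dec A → ℚ → ℚ
  sel (yes _) q = q
  sel (no  _) q = 0ℚ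

unfold : {n k : ℕ} → (Fin n → Fin k) → (Fin k → ℚ) → Fin n → ℚ
unfold σ z v = z (σ v)

record Polytope (n : ℕ) : Set where
  field
    m : ℕ
    A : Fin m → Fin n → ℚ
    b : Fin m → ℚ

_∈P_ : {n : ℕ} → (Fin n → ℚ) → Polytope n → Set
x ∈P P = (j : Fin m) → dot (A j) x ≤ b j
  where open Polytope P

_∈Fold[_]_ : {n k : ℕ} → (Fin k → ℚ) → (Fin n → Fin k) → Polytope n → Set
z ∈Fold[ σ ] P = ∃ λ x → (x ∈P P) × ((i : _) → fold σ x i ≡ z i)

AgreesWith : {n k : ℕ} → (Fin n → ℚ) → (Fin n → Fin k) → Set
AgreesWith c σ = ∀ v v' → σ v ≡ σ v' → c v ≡ c v'

-- c^T x > max{c^T y : y ∈ P}, read as: c^T y < c^T x for all y ∈ P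
Separates : {n : ℕ} → (Fin n → ℚ) → Polytope n → (Fin n → ℚ) → Set
Separates c P x = ∀ y → y ∈P P → dot c y < dot c x

AllSepDisagree : {n k : ℕ} → Polytope n → (Fin n → Fin k) → (Fin n → ℚ) → Set
AllSepDisagree P σ x = ¬ (∃ λ c → AgreesWith c σ × Separates c P x)

-- An agreeing functional c factors through folding: c = foldᵀ γ with foldᵀ γ v = γ (σ v) / |V_σ(v)|,
-- the transpose of x ↦ x^σ, so c·x = γ·x^σ. Hence if z = x^σ with x ∈ P, then c·z^{-σ} = γ·z = c·x,
-- and no agreeing c separates z^{-σ} from P.
--
-- Conversely, P^σ is the projection onto z of the polyhedron {(x, z) : x ∈ P, x^σ = z}.
-- Fourier–Motzkin elimination of x, with z carried along as parameters, describes it by finitely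
-- many inequalities γ·z ≤ β, each valid on P^σ. If z^{-σ} ∈ P then z = (z^{-σ})^σ. Otherwise, when
-- all separating hyperplanes at z^{-σ} disagree with σ, each of these inequalities holds at z: a violated
-- one would give foldᵀ γ·y = γ·y^σ ≤ β < γ·z = foldᵀ γ·z^{-σ} for all y ∈ P, with foldᵀ γ agreeing.

module Submission where

open import Defs
open import Algebra.Bundles using (CommutativeRing)
open import Data.Nat as ℕ using (ℕ; zero; suc)
open import Data.Fin using (Fin; zero; suc; _≟_)
import Data.Integer as ℤ
import Data.Integer.Properties as ℤ
open import Data.Nat.Coprimality as Coprime using (1-coprimeTo)
open import Data.Rational
  using (ℚ; 0ℚ; 1ℚ; _+_; _*_; _-_; -_; _≤_; _<_; 1/_; Positive; NonZero; positive)
open import Data.Rational.Literals using (fromℤ)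
open import Data.Rational.Properties
  using ( +-*-commutativeRing; ≤-decTotalOrder; /-cong; normalize-coprime
        ; *-inverseˡ; *-identityˡ; *-zeroˡ; *-zeroʳ; +-identityˡ; +-identityʳ
        ; +-monoˡ-≤; *-monoˡ-≤-nonNeg; *-cancelˡ-≤-pos; pos⇒nonNeg; 1/pos⇒pos
        ; neg-antimono-<; ≤-trans; ≤-antisym; ≤-reflexive; module ≤-Reasoning; <-cmp; _≤?_; ≰⇒>; <-irrefl
        ; *-assoc; *-identityʳ; *-distribʳ-+; +-inverseʳ; pos⇒nonZero )
open import Data.Rational.Solver using (module +-*-Solver)
open import Data.Vec.Functional as Vec using (Vector; head; tail)
open import Data.List using (List; []; _∷_; _++_; map; foldr; tabulate; cartesianProductWith)
open import Data.List.Relation.Unary.All as All using (All; []; _∷_)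
open import Data.List.Membership.Propositional using (_∈_)
open import Data.List.Relation.Unary.All.Properties using (++⁺; ++⁻; map⁺; map⁻; tabulate⁺; tabulate⁻)
open import Data.Bool using (if_then_else_)
open import Data.Product using (Σ; ∃; _×_; _,_; proj₁; proj₂)
open import Data.Sum using (_⊎_; inj₁; inj₂)
open import Data.Empty using (⊥-elim)
open import Function using (_⇔_; mk⇔; Equivalence; _∘_)
import Function.Properties.Equivalence as ⇔
open import Relation.Binary.Bundles using (DecTotalOrder)
open import Data.List.Extrema (DecTotalOrder.totalOrder ≤-decTotalOrder) using (min; max; min≤xs; xs≤max; max≤v⁺)
open import Relation.Binary.Definitions using (tri<; tri≈; tri>)
open import Relation.Binary.PropositionalEquality
open import Relation.Nullary using (Dec; does; yes; no)

open import Algebra.Properties.Semiring.Sum (CommutativeRing.semiring +-*-commutativeRing)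
  using (sum-syntax; sum-cong-≗; sum-replicate-zero; ∑-distrib-+; ∑-comm; *-distribˡ-sum; *-distribʳ-sum)

open +-*-Solver using (solve; _:=_; _:+_; _:*_; :-_; _:-_; con)
open Equivalence using (to; from)

sumFin≡∑ : ∀ n (f : Vector ℚ n) → sumFin n f ≡ ∑[ v < n ] f v
sumFin≡∑ zero    f = refl
sumFin≡∑ (suc n) f = cong (f zero +_) (sumFin≡∑ n (λ v → f (suc v)))

dot≡∑ : ∀ {n} (c x : Vector ℚ n) → dot c x ≡ ∑[ v < n ] (c v * x v)
dot≡∑ {n} c x = sumFin≡∑ n (λ v → c v * x v)

dot-congˡ : ∀ {n} {c c′ : Vector ℚ n} x → c ≗ c′ → dot c x ≡ dot c′ x
dot-congˡ {c = c} {c′} x c≗c′ =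
  trans (dot≡∑ c x) (trans (sum-cong-≗ (λ v → cong (_* x v) (c≗c′ v))) (sym (dot≡∑ c′ x)))

dot-congʳ : ∀ {n} c {x x′ : Vector ℚ n} → x ≗ x′ → dot c x ≡ dot c x′
dot-congʳ c {x} {x′} x≗x′ =
  trans (dot≡∑ c x) (trans (sum-cong-≗ (λ v → cong (c v *_) (x≗x′ v))) (sym (dot≡∑ c x′)))

dot-zeroˡ : ∀ {n} (x : Vector ℚ n) → dot (λ _ → 0ℚ) x ≡ 0ℚ
dot-zeroˡ {n} x = trans (dot≡∑ (λ _ → 0ℚ) x) (trans (sum-cong-≗ (λ v → *-zeroˡ (x v))) (sum-replicate-zero n))

dot-+ˡ : ∀ {n} (a b x : Vector ℚ n) → dot (λ v → a v + b v) x ≡ dot a x + dot b x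
dot-+ˡ a b x = begin
  dot (λ v → a v + b v) x                          ≡⟨ dot≡∑ (λ v → a v + b v) x ⟩
  ∑[ v < _ ] ((a v + b v) * x v)                   ≡⟨ sum-cong-≗ (λ v → *-distribʳ-+ (x v) (a v) (b v)) ⟩
  ∑[ v < _ ] (a v * x v + b v * x v)               ≡⟨ ∑-distrib-+ (λ v → a v * x v) (λ v → b v * x v) ⟩
  ∑[ v < _ ] (a v * x v) + ∑[ v < _ ] (b v * x v)  ≡⟨ cong₂ _+_ (dot≡∑ a x) (dot≡∑ b x) ⟨
  dot a x + dot b x                                ∎
  where open ≡-Reasoning

dot-*ˡ : ∀ {n} t (a x : Vector ℚ n) → dot (λ v → t * a v) x ≡ t * dot a x
dot-*ˡ t a x = begin
  dot (λ v → t * a v) x          ≡⟨ dot≡∑ (λ v → t * a v) x ⟩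
  ∑[ v < _ ] (t * a v * x v)     ≡⟨ sum-cong-≗ (λ v → *-assoc t (a v) (x v)) ⟩
  ∑[ v < _ ] (t * (a v * x v))   ≡⟨ *-distribˡ-sum t (λ v → a v * x v) ⟨
  t * ∑[ v < _ ] (a v * x v)     ≡⟨ cong (t *_) (dot≡∑ a x) ⟨
  t * dot a x                    ∎
  where open ≡-Reasoning

subst⇔ : ∀ {A : Set} (P : A → Set) {a b} → a ≡ b → P a ⇔ P b
subst⇔ P refl = ⇔.refl

0≤p-q⇔q≤p : ∀ {p q} → 0ℚ ≤ p - q ⇔ q ≤ p
0≤p-q⇔q≤p {p} {q} = mk⇔
  (λ 0≤p-q → subst₂ _≤_ (+-identityˡ q) (solve 2 (λ p q → (p :- q) :+ q := p) refl p q) (+-monoˡ-≤ q 0≤p-q))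
  (λ q≤p → subst (_≤ p - q) (+-inverseʳ q) (+-monoˡ-≤ (- q) q≤p))

0≤p⇔0≤r*p : ∀ r .{{_ : Positive r}} {p} → 0ℚ ≤ p ⇔ 0ℚ ≤ r * p
0≤p⇔0≤r*p r {p} = mk⇔
  (λ 0≤p → subst (_≤ r * p) (*-zeroʳ r) (*-monoˡ-≤-nonNeg r {{pos⇒nonNeg r}} 0≤p))
  (λ 0≤rp → *-cancelˡ-≤-pos r (subst (_≤ r * p) (sym (*-zeroʳ r)) 0≤rp))

scaleToOne : ∀ {r} → 0ℚ < r → Σ ℚ λ t → Positive t × t * r ≡ 1ℚ
scaleToOne {r} r>0 = 1/ r , 1/pos⇒pos r , *-inverseˡ r
  where
  instance
    r-pos : Positive r
    r-pos = positive r>0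
    r≢0 : NonZero r
    r≢0 = pos⇒nonZero r

scaleToMinusOne : ∀ {r} → r < 0ℚ → Σ ℚ λ t → Positive t × t * r ≡ - 1ℚ
scaleToMinusOne {r} r<0 with scaleToOne (neg-antimono-< r<0)
... | t , t>0 , t[-r]≡1 = t , t>0 , (begin
  t * r        ≡⟨ solve 2 (λ t r → t :* r := :- (t :* (:- r))) refl t r ⟩
  - (t * - r)  ≡⟨ cong -_ t[-r]≡1 ⟩
  - 1ℚ         ∎)
  where open ≡-Reasoning

cartesianProductWith-All⁺ : ∀ {A B C : Set} {P : C → Set} (f : A → B → C) {xs ys} →
  All (λ x → All (λ y → P (f x y)) ys) xs → All P (cartesianProductWith f xs ys)
cartesianProductWith-All⁺ f []       = []
cartesianProductWith-All⁺ f (h ∷ hs) = ++⁺ (map⁺ h) (cartesianProductWith-All⁺ f hs)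

cartesianProductWith-All⁻ : ∀ {A B C : Set} {P : C → Set} (f : A → B → C) xs {ys} →
  All P (cartesianProductWith f xs ys) → All (λ x → All (λ y → P (f x y)) ys) xs
cartesianProductWith-All⁻ f []       _ = []
cartesianProductWith-All⁻ f (x ∷ xs) h =
  map⁻ (proj₁ (++⁻ _ h)) ∷ cartesianProductWith-All⁻ f xs (proj₂ (++⁻ _ h))

-- Fourier–Motzkin elimination with parameters

module FourierMotzkin (N : ℕ) where

  record Constraint (n : ℕ) : Set where
    constructor constraint
    field
      coeff : Vector ℚ n
      param : Vector ℚ N
      bound : ℚ
  open Constraint public

  slack : ∀ {n} → Vector ℚ n → Vector ℚ N → Constraint n → ℚ
  slack x u k = bound k - (dot (coeff k) x + dot (param k) u)

  Holds : ∀ {n} → Vector ℚ n → Vector ℚ N → Constraint n → Set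
  Holds x u k = 0ℚ ≤ slack x u k

  Holds⇔ : ∀ {n} (x : Vector ℚ n) u k → Holds x u k ⇔ dot (coeff k) x + dot (param k) u ≤ bound k
  Holds⇔ x u k = 0≤p-q⇔q≤p

  Holds[]⇔ : ∀ u (k : Constraint 0) → Holds Vec.[] u k ⇔ dot (param k) u ≤ bound k
  Holds[]⇔ u k = ⇔.trans (Holds⇔ Vec.[] u k) (subst⇔ (_≤ bound k) (+-identityˡ (dot (param k) u)))

  infixl 6 _⊕_
  infixr 7 _⊛_

  _⊕_ : ∀ {n} → Constraint n → Constraint n → Constraint n
  p ⊕ q = constraint (λ v → coeff p v + coeff q v) (λ w → param p w + param q w) (bound p + bound q)

  _⊛_ : ∀ {n} → ℚ → Constraint n → Constraint n
  t ⊛ k = constraint (λ v → t * coeff k v) (λ w → t * param k w) (t * bound k)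

  dropFirst : ∀ {n} → Constraint (suc n) → Constraint n
  dropFirst k = constraint (tail (coeff k)) (param k) (bound k)

  slack-⊕ : ∀ {n} (x : Vector ℚ n) u p q → slack x u (p ⊕ q) ≡ slack x u p + slack x u q
  slack-⊕ x u p q = begin
    bound p + bound q - (dot (λ v → coeff p v + coeff q v) x + dot (λ w → param p w + param q w) u)
      ≡⟨ cong₂ (λ a c → bound p + bound q - (a + c)) (dot-+ˡ (coeff p) (coeff q) x) (dot-+ˡ (param p) (param q) u) ⟩
    bound p + bound q - ((dot (coeff p) x + dot (coeff q) x) + (dot (param p) u + dot (param q) u))
      ≡⟨ solve 6 (λ β γ a b c d → β :+ γ :- ((a :+ b) :+ (c :+ d)) := (β :- (a :+ c)) :+ (γ :- (b :+ d))) refl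
           (bound p) (bound q) (dot (coeff p) x) (dot (coeff q) x) (dot (param p) u) (dot (param q) u) ⟩
    slack x u p + slack x u q ∎
    where open ≡-Reasoning

  slack-⊛ : ∀ {n} (x : Vector ℚ n) u t k → slack x u (t ⊛ k) ≡ t * slack x u k
  slack-⊛ x u t k = begin
    t * bound k - (dot (λ v → t * coeff k v) x + dot (λ w → t * param k w) u)
      ≡⟨ cong₂ (λ a c → t * bound k - (a + c)) (dot-*ˡ t (coeff k) x) (dot-*ˡ t (param k) u) ⟩
    t * bound k - (t * dot (coeff k) x + t * dot (param k) u)
      ≡⟨ solve 4 (λ t β a c → t :* β :- (t :* a :+ t :* c) := t :* (β :- (a :+ c))) refl
           t (bound k) (dot (coeff k) x) (dot (param k) u) ⟩
    t * slack x u k ∎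
    where open ≡-Reasoning

  slack-∷ : ∀ {n} x₀ (x : Vector ℚ n) u k → slack (x₀ Vec.∷ x) u k ≡ slack x u (dropFirst k) - coeff k zero * x₀
  slack-∷ x₀ x u k = solve 4 (λ β a d e → β :- ((a :+ d) :+ e) := (β :- (d :+ e)) :- a) refl
    (bound k) (coeff k zero * x₀) (dot (tail (coeff k)) x) (dot (param k) u)

  data Role (n : ℕ) : Set where
    free upper lower : Constraint n → Role n

  role : ∀ {n} → Constraint (suc n) → Role n
  role k with <-cmp (coeff k zero) 0ℚ
  ... | tri< a<0 _ _ = lower (proj₁ (scaleToMinusOne a<0) ⊛ dropFirst k)
  ... | tri≈ _ _ _   = free (dropFirst k)
  ... | tri> _ _ a>0 = upper (proj₁ (scaleToOne a>0) ⊛ dropFirst k)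

  RoleHolds : ∀ {n} → ℚ → Vector ℚ n → Vector ℚ N → Role n → Set
  RoleHolds x₀ x u (free k)  = Holds x u k
  RoleHolds x₀ x u (upper k) = x₀ ≤ slack x u k
  RoleHolds x₀ x u (lower k) = - slack x u k ≤ x₀

  Holds-∷⇔ : ∀ {n c} x₀ (x : Vector ℚ n) u k ((t , _ , _) : Σ ℚ λ t → Positive t × t * coeff k zero ≡ c) →
    Holds (x₀ Vec.∷ x) u k ⇔ 0ℚ ≤ slack x u (t ⊛ dropFirst k) - c * x₀
  Holds-∷⇔ {c = c} x₀ x u k (t , t>0 , ta≡c) = ⇔.trans (0≤p⇔0≤r*p t {{t>0}}) (subst⇔ (0ℚ ≤_) (begin
    t * slack (x₀ Vec.∷ x) u k                           ≡⟨ cong (t *_) (slack-∷ x₀ x u k) ⟩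
    t * (slack x u (dropFirst k) - coeff k zero * x₀)     ≡⟨ solve 4 (λ t s a y → t :* (s :- a :* y) := t :* s :- t :* a :* y) refl
                                                              t (slack x u (dropFirst k)) (coeff k zero) x₀ ⟩
    t * slack x u (dropFirst k) - t * coeff k zero * x₀   ≡⟨ cong₂ (λ s d → s - d * x₀) (sym (slack-⊛ x u t (dropFirst k))) ta≡c ⟩
    slack x u (t ⊛ dropFirst k) - c * x₀                  ∎))
    where open ≡-Reasoning

  role-correct : ∀ {n} x₀ (x : Vector ℚ n) u k → Holds (x₀ Vec.∷ x) u k ⇔ RoleHolds x₀ x u (role k)
  role-correct x₀ x u k with <-cmp (coeff k zero) 0ℚ
  ... | tri≈ _ a≡0 _ = subst⇔ (0ℚ ≤_) (begin
    slack (x₀ Vec.∷ x) u k                        ≡⟨ slack-∷ x₀ x u k ⟩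
    slack x u (dropFirst k) - coeff k zero * x₀   ≡⟨ cong (λ a → slack x u (dropFirst k) - a * x₀) a≡0 ⟩
    slack x u (dropFirst k) - 0ℚ * x₀             ≡⟨ solve 2 (λ s y → s :- con 0ℚ :* y := s) refl (slack x u (dropFirst k)) x₀ ⟩
    slack x u (dropFirst k)                       ∎)
    where open ≡-Reasoning
  ... | tri> _ _ a>0 = ⇔.trans (Holds-∷⇔ x₀ x u k (scaleToOne a>0)) (⇔.trans (subst⇔ (0ℚ ≤_) s-1y≡s-y) 0≤p-q⇔q≤p)
    where
    s : ℚ
    s = slack x u (proj₁ (scaleToOne a>0) ⊛ dropFirst k)
    s-1y≡s-y : s - 1ℚ * x₀ ≡ s - x₀
    s-1y≡s-y = solve 2 (λ s y → s :- con 1ℚ :* y := s :- y) refl s x₀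
  ... | tri< a<0 _ _ = ⇔.trans (Holds-∷⇔ x₀ x u k (scaleToMinusOne a<0)) (⇔.trans (subst⇔ (0ℚ ≤_) s+y≡y--s) 0≤p-q⇔q≤p)
    where
    s : ℚ
    s = slack x u (proj₁ (scaleToMinusOne a<0) ⊛ dropFirst k)
    s+y≡y--s : s - - 1ℚ * x₀ ≡ x₀ - - s
    s+y≡y--s = solve 2 (λ s y → s :- (:- con 1ℚ) :* y := y :- (:- s)) refl s x₀

  record Split (n : ℕ) : Set where
    constructor split
    field
      frees uppers lowers : List (Constraint n)

  insert : ∀ {n} → Role n → Split n → Split n
  insert (free k)  (split F U L) = split (k ∷ F) U L
  insert (upper k) (split F U L) = split F (k ∷ U) L
  insert (lower k) (split F U L) = split F U (k ∷ L)

  classify : ∀ {n} → List (Constraint (suc n)) → Split n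
  classify = foldr (insert ∘ role) (split [] [] [])

  SplitHolds : ∀ {n} → ℚ → Vector ℚ n → Vector ℚ N → Split n → Set
  SplitHolds x₀ x u (split F U L) =
    All (Holds x u) F × All (λ k → x₀ ≤ slack x u k) U × All (λ k → - slack x u k ≤ x₀) L

  insert-correct : ∀ {n} x₀ (x : Vector ℚ n) u r s →
    SplitHolds x₀ x u (insert r s) ⇔ (RoleHolds x₀ x u r × SplitHolds x₀ x u s)
  insert-correct x₀ x u (free k) (split F U L) =
    mk⇔ (λ { (h ∷ hF , hU , hL) → h , hF , hU , hL }) (λ (h , hF , hU , hL) → h ∷ hF , hU , hL)
  insert-correct x₀ x u (upper k) (split F U L) =
    mk⇔ (λ { (hF , h ∷ hU , hL) → h , hF , hU , hL }) (λ (h , hF , hU , hL) → hF , h ∷ hU , hL)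
  insert-correct x₀ x u (lower k) (split F U L) =
    mk⇔ (λ { (hF , hU , h ∷ hL) → h , hF , hU , hL }) (λ (h , hF , hU , hL) → hF , hU , h ∷ hL)

  classify-correct : ∀ {n} x₀ (x : Vector ℚ n) u S →
    All (Holds (x₀ Vec.∷ x) u) S ⇔ SplitHolds x₀ x u (classify S)
  classify-correct x₀ x u []      = mk⇔ (λ _ → [] , [] , []) (λ _ → [])
  classify-correct x₀ x u (k ∷ S) = mk⇔
    (λ { (h ∷ hS) → from (insert-correct x₀ x u (role k) (classify S))
                       (to (role-correct x₀ x u k) h , to (classify-correct x₀ x u S) hS) })
    (λ h → let (hk , hS) = to (insert-correct x₀ x u (role k) (classify S)) h
           in from (role-correct x₀ x u k) hk ∷ from (classify-correct x₀ x u S) hS)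

  ⊕-Holds⇔ : ∀ {n} (x : Vector ℚ n) u p q → Holds x u (p ⊕ q) ⇔ - slack x u q ≤ slack x u p
  ⊕-Holds⇔ x u p q = ⇔.trans (subst⇔ (0ℚ ≤_) (begin
    slack x u (p ⊕ q)                  ≡⟨ slack-⊕ x u p q ⟩
    slack x u p + slack x u q          ≡⟨ solve 2 (λ a b → a :+ b := a :- (:- b)) refl (slack x u p) (slack x u q) ⟩
    slack x u p - - slack x u q        ∎)) 0≤p-q⇔q≤p
    where open ≡-Reasoning

  combine : ∀ {n} → Split n → List (Constraint n)
  combine (split F U L) = F ++ cartesianProductWith _⊕_ U L

  -- The witness is the largest lower bound, or (without lower bounds) the smallest upper bound.
  combine-correct : ∀ {n} (x : Vector ℚ n) u s → (∃ λ x₀ → SplitHolds x₀ x u s) ⇔ All (Holds x u) (combine s)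
  combine-correct x u (split F U L) = mk⇔ sound complete
    where
    sound : (∃ λ x₀ → SplitHolds x₀ x u (split F U L)) → All (Holds x u) (combine (split F U L))
    sound (x₀ , hF , hU , hL) = ++⁺ hF (cartesianProductWith-All⁺ _⊕_
      (All.map (λ {p} x₀≤p → All.map (λ {q} q≤x₀ → from (⊕-Holds⇔ x u p q) (≤-trans q≤x₀ x₀≤p)) hL) hU))
    complete : All (Holds x u) (combine (split F U L)) → ∃ λ x₀ → SplitHolds x₀ x u (split F U L)
    complete h = x₀ , hF , hU , map⁻ (xs≤max _ (map (λ q → - slack x u q) L))
      where
      hF : All (Holds x u) F
      hF = proj₁ (++⁻ F h)
      hUL : All (λ p → All (λ q → - slack x u q ≤ slack x u p) L) U
      hUL = All.map (λ {p} → All.map (λ {q} → to (⊕-Holds⇔ x u p q))) (cartesianProductWith-All⁻ _⊕_ U (proj₂ (++⁻ F h)))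
      x₀ : ℚ
      x₀ = max (min 0ℚ (map (slack x u) U)) (map (λ q → - slack x u q) L)
      hU : All (λ p → x₀ ≤ slack x u p) U
      hU = All.zipWith (λ (min≤p , L≤p) → max≤v⁺ min≤p (map⁺ L≤p)) (map⁻ (min≤xs 0ℚ (map (slack x u) U)) , hUL)

  eliminate : ∀ {n} → List (Constraint (suc n)) → List (Constraint n)
  eliminate = combine ∘ classify

  eliminate-correct : ∀ {n} (x : Vector ℚ n) u S →
    (∃ λ x₀ → All (Holds (x₀ Vec.∷ x) u) S) ⇔ All (Holds x u) (eliminate S)
  eliminate-correct x u S = ⇔.trans
    (mk⇔ (λ (x₀ , h) → x₀ , to (classify-correct x₀ x u S) h) (λ (x₀ , h) → x₀ , from (classify-correct x₀ x u S) h))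
    (combine-correct x u (classify S))

  project : ∀ n → List (Constraint n) → List (Constraint 0)
  project zero    S = S
  project (suc n) S = project n (eliminate S)

  project-correct : ∀ n (S : List (Constraint n)) u → (∃ λ x → All (Holds x u) S) ⇔ All (Holds Vec.[] u) (project n S)
  project-correct zero    S u = mk⇔ proj₂ (Vec.[] ,_)
  project-correct (suc n) S u = mk⇔
    (λ (x , h) → to (project-correct n (eliminate S) u) (tail x , to (eliminate-correct (tail x) u S) (head x , h)))
    (λ h → let (x , hx) = from (project-correct n (eliminate S) u) h
               (x₀ , hx₀) = from (eliminate-correct x u S) hx
           in x₀ Vec.∷ x , hx₀)

-- Folding along σ

𝟙 : ∀ {A : Set} → Dec A → ℚ
𝟙 d = if does d then 1ℚ else 0ℚ

∑-𝟙-δ : ∀ {k} (i : Fin k) (f : Vector ℚ k) → ∑[ j < k ] (𝟙 (i ≟ j) * f j) ≡ f i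
∑-𝟙-δ {suc k} zero f = begin
  1ℚ * f zero + ∑[ j < k ] (0ℚ * f (suc j))   ≡⟨ cong₂ _+_ (*-identityˡ (f zero)) (sum-cong-≗ (λ j → *-zeroˡ (f (suc j)))) ⟩
  f zero + ∑[ j < k ] 0ℚ                       ≡⟨ cong (f zero +_) (sum-replicate-zero k) ⟩
  f zero + 0ℚ                                  ≡⟨ +-identityʳ (f zero) ⟩
  f zero                                       ∎
  where open ≡-Reasoning
∑-𝟙-δ {suc k} (suc i) f = begin
  0ℚ * f zero + ∑[ j < k ] (𝟙 (i ≟ j) * f (suc j))   ≡⟨ cong (_+ ∑[ j < k ] (𝟙 (i ≟ j) * f (suc j))) (*-zeroˡ (f zero)) ⟩
  0ℚ + ∑[ j < k ] (𝟙 (i ≟ j) * f (suc j))            ≡⟨ +-identityˡ _ ⟩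
  ∑[ j < k ] (𝟙 (i ≟ j) * f (suc j))                 ≡⟨ ∑-𝟙-δ i (λ j → f (suc j)) ⟩
  f (suc i)                                           ∎
  where open ≡-Reasoning

𝟙-*-subst : ∀ {k} {i j : Fin k} (f : Vector ℚ k) → 𝟙 (i ≟ j) * f i ≡ 𝟙 (i ≟ j) * f j
𝟙-*-subst {i = i} {j} f with i ≟ j
... | yes refl = refl
... | no  _    = trans (*-zeroˡ (f i)) (sym (*-zeroˡ (f j)))

fromℤ-suc : ∀ m → 1ℚ + fromℤ (ℤ.+ m) ≡ fromℤ (ℤ.+ suc m)
fromℤ-suc m = trans (/-cong (cong (ℤ._+_ (ℤ.+ 1)) (ℤ.*-identityʳ (ℤ.+ m))) refl)
                    (normalize-coprime (Coprime.sym (1-coprimeTo (suc m))))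

inv*fromℤ : ∀ c .{{_ : ℕ.NonZero c}} → inv c * fromℤ (ℤ.+ c) ≡ 1ℚ
inv*fromℤ (suc m) = trans (cong (_* fromℤ (ℤ.+ suc m)) (normalize-coprime (1-coprimeTo (suc m))))
                          (*-inverseˡ (fromℤ (ℤ.+ suc m)))

∑-𝟙≡card : ∀ {n k} (σ : Fin n → Fin k) i → ∑[ v < n ] 𝟙 (σ v ≟ i) ≡ fromℤ (ℤ.+ card σ i)
∑-𝟙≡card {zero}  σ i = refl
∑-𝟙≡card {suc n} σ i with σ zero ≟ i
... | yes _ = trans (cong (1ℚ +_) (∑-𝟙≡card (σ ∘ suc) i)) (fromℤ-suc (card (σ ∘ suc) i))
... | no  _ = trans (+-identityˡ _) (∑-𝟙≡card (σ ∘ suc) i)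

card-nonZero : ∀ {n k} (σ : Fin n → Fin k) {i} v → σ v ≡ i → ℕ.NonZero (card σ i)
card-nonZero {suc n} σ {i} v σv≡i with σ zero ≟ i | v
... | yes _    | _     = _
... | no σ0≢i  | zero  = ⊥-elim (σ0≢i σv≡i)
... | no _     | suc w = card-nonZero (σ ∘ suc) w σv≡i

-- The summand of fold is local to its where-block; unification recovers it.
foldSummand : ∀ {n k} (σ : Fin n → Fin k) (x : Vector ℚ n) i →
  Σ (Vector ℚ n) λ f → fold σ x i ≡ inv (card σ i) * sumFin n f
foldSummand σ x i = _ , refl

foldSummand≡ : ∀ {n k} (σ : Fin n → Fin k) (x : Vector ℚ n) i v → proj₁ (foldSummand σ x i) v ≡ 𝟙 (σ v ≟ i) * x v
foldSummand≡ σ x i v with σ v ≟ i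
... | yes _ = sym (*-identityˡ (x v))
... | no  _ = sym (*-zeroˡ (x v))

module _ {n k} (σ : Fin n → Fin k) where

  fold≡∑ : ∀ (x : Vector ℚ n) i → fold σ x i ≡ inv (card σ i) * ∑[ v < n ] (𝟙 (σ v ≟ i) * x v)
  fold≡∑ x i = cong (inv (card σ i) *_) (trans (sumFin≡∑ n (proj₁ (foldSummand σ x i))) (sum-cong-≗ (foldSummand≡ σ x i)))

  foldᵀ : Vector ℚ k → Vector ℚ n
  foldᵀ γ v = γ (σ v) * inv (card σ (σ v))

  dot-fold : ∀ γ (x : Vector ℚ n) → dot γ (fold σ x) ≡ dot (foldᵀ γ) x
  dot-fold γ x = begin
    dot γ (fold σ x)
      ≡⟨ dot≡∑ γ (fold σ x) ⟩
    ∑[ i < k ] (γ i * fold σ x i)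
      ≡⟨ sum-cong-≗ (λ i → trans (cong (γ i *_) (fold≡∑ x i)) (sym (*-assoc (γ i) (inv (card σ i)) _))) ⟩
    ∑[ i < k ] (γ i * inv (card σ i) * ∑[ v < n ] (𝟙 (σ v ≟ i) * x v))
      ≡⟨ sum-cong-≗ (λ i → *-distribˡ-sum (γ i * inv (card σ i)) (λ v → 𝟙 (σ v ≟ i) * x v)) ⟩
    ∑[ i < k ] ∑[ v < n ] (γ i * inv (card σ i) * (𝟙 (σ v ≟ i) * x v))
      ≡⟨ ∑-comm (λ i v → γ i * inv (card σ i) * (𝟙 (σ v ≟ i) * x v)) ⟩
    ∑[ v < n ] ∑[ i < k ] (γ i * inv (card σ i) * (𝟙 (σ v ≟ i) * x v))
      ≡⟨ sum-cong-≗ (λ v → sum-cong-≗ (λ i → solve 3 (λ g d y → g :* (d :* y) := d :* (g :* y)) refl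
                                              (γ i * inv (card σ i)) (𝟙 (σ v ≟ i)) (x v))) ⟩
    ∑[ v < n ] ∑[ i < k ] (𝟙 (σ v ≟ i) * (γ i * inv (card σ i) * x v))
      ≡⟨ sum-cong-≗ (λ v → ∑-𝟙-δ (σ v) (λ i → γ i * inv (card σ i) * x v)) ⟩
    ∑[ v < n ] (foldᵀ γ v * x v)
      ≡⟨ dot≡∑ (foldᵀ γ) x ⟨
    dot (foldᵀ γ) x ∎
    where open ≡-Reasoning

  foldᵀ-agrees : ∀ γ → AgreesWith (foldᵀ γ) σ
  foldᵀ-agrees γ v v′ σv≡σv′ = cong (λ i → γ i * inv (card σ i)) σv≡σv′

  module _ (onto : ∀ i → ∃ λ v → σ v ≡ i) where

    fold-unfold : ∀ z → fold σ (unfold σ z) ≗ z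
    fold-unfold z i = begin
      fold σ (unfold σ z) i                            ≡⟨ fold≡∑ (unfold σ z) i ⟩
      inv c * ∑[ v < n ] (𝟙 (σ v ≟ i) * z (σ v))       ≡⟨ cong (inv c *_) (sum-cong-≗ (λ v → 𝟙-*-subst {i = σ v} {i} z)) ⟩
      inv c * ∑[ v < n ] (𝟙 (σ v ≟ i) * z i)           ≡⟨ cong (inv c *_) (*-distribʳ-sum (z i) (λ v → 𝟙 (σ v ≟ i))) ⟨
      inv c * (∑[ v < n ] 𝟙 (σ v ≟ i) * z i)           ≡⟨ cong (λ s → inv c * (s * z i)) (∑-𝟙≡card σ i) ⟩
      inv c * (fromℤ (ℤ.+ c) * z i)                    ≡⟨ *-assoc (inv c) (fromℤ (ℤ.+ c)) (z i) ⟨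
      inv c * fromℤ (ℤ.+ c) * z i                      ≡⟨ cong (_* z i) (inv*fromℤ c {{c≢0}}) ⟩
      1ℚ * z i                                         ≡⟨ *-identityˡ (z i) ⟩
      z i                                              ∎
      where
      open ≡-Reasoning
      c : ℕ
      c = card σ i
      c≢0 : ℕ.NonZero c
      c≢0 = card-nonZero σ (proj₁ (onto i)) (proj₂ (onto i))

    agrees⇒foldᵀ : ∀ {c} → AgreesWith c σ → ∃ λ γ → c ≗ foldᵀ γ
    agrees⇒foldᵀ {c} c~σ = γ , c≗foldᵀγ
      where
      rep : Fin k → Fin n
      rep i = proj₁ (onto i)
      γ : Vector ℚ k
      γ i = c (rep i) * fromℤ (ℤ.+ card σ i)
      c≗foldᵀγ : c ≗ foldᵀ γ
      c≗foldᵀγ v = begin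
        c v                                         ≡⟨ c~σ v (rep (σ v)) (sym (proj₂ (onto (σ v)))) ⟩
        c (rep (σ v))                               ≡⟨ *-identityʳ (c (rep (σ v))) ⟨
        c (rep (σ v)) * 1ℚ                          ≡⟨ cong (c (rep (σ v)) *_) (inv*fromℤ _ {{card-nonZero σ v refl}}) ⟨
        c (rep (σ v)) * (inv m * fromℤ (ℤ.+ m))     ≡⟨ solve 3 (λ a i f → a :* (i :* f) := a :* f :* i) refl
                                                          (c (rep (σ v))) (inv m) (fromℤ (ℤ.+ m)) ⟩
        foldᵀ γ v                                   ∎
        where
        open ≡-Reasoning
        m : ℕ
        m = card σ (σ v)

    dot-unfold : ∀ {c x z} → AgreesWith c σ → fold σ x ≗ z → dot c (unfold σ z) ≡ dot c x
    dot-unfold {c} {x} {z} c~σ fold≗z = begin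
      dot c (unfold σ z)                  ≡⟨ dot-congˡ (unfold σ z) c≗foldᵀγ ⟩
      dot (foldᵀ γ) (unfold σ z)          ≡⟨ dot-fold γ (unfold σ z) ⟨
      dot γ (fold σ (unfold σ z))         ≡⟨ dot-congʳ γ (fold-unfold z) ⟩
      dot γ z                             ≡⟨ dot-congʳ γ (λ i → sym (fold≗z i)) ⟩
      dot γ (fold σ x)                    ≡⟨ dot-fold γ x ⟩
      dot (foldᵀ γ) x                     ≡⟨ dot-congˡ x c≗foldᵀγ ⟨
      dot c x                             ∎
      where
      open ≡-Reasoning
      γ : Vector ℚ k
      γ = proj₁ (agrees⇒foldᵀ c~σ)
      c≗foldᵀγ : c ≗ foldᵀ γ
      c≗foldᵀγ = proj₂ (agrees⇒foldᵀ c~σ)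

module _ {n k} (P : Polytope n) (σ : Fin n → Fin k) where
  open Polytope P
  open FourierMotzkin k

  facetRow : Fin m → Constraint n
  facetRow j = constraint (A j) (λ _ → 0ℚ) (b j)

  foldRow : Fin k → Constraint n
  foldRow i = constraint (foldᵀ σ (λ j → 𝟙 (i ≟ j))) (λ j → - 1ℚ * 𝟙 (i ≟ j)) 0ℚ

  fibreSystem : List (Constraint n)
  fibreSystem = tabulate facetRow ++ tabulate foldRow ++ tabulate (λ i → - 1ℚ ⊛ foldRow i)

  facetRow-Holds⇔ : ∀ x z j → Holds x z (facetRow j) ⇔ dot (A j) x ≤ b j
  facetRow-Holds⇔ x z j = ⇔.trans (Holds⇔ x z (facetRow j))
    (subst⇔ (_≤ b j) (trans (cong (dot (A j) x +_) (dot-zeroˡ z)) (+-identityʳ (dot (A j) x))))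

  slack-foldRow : ∀ x z i → slack x z (foldRow i) ≡ z i - fold σ x i
  slack-foldRow x z i = begin
    0ℚ - (dot (foldᵀ σ δᵢ) x + dot (λ j → - 1ℚ * δᵢ j) z)
      ≡⟨ cong₂ (λ a c → 0ℚ - (a + c)) (sym (dot-fold σ δᵢ x)) (dot-*ˡ (- 1ℚ) δᵢ z) ⟩
    0ℚ - (dot δᵢ (fold σ x) + - 1ℚ * dot δᵢ z)
      ≡⟨ cong₂ (λ a c → 0ℚ - (a + - 1ℚ * c)) (dot-δ (fold σ x)) (dot-δ z) ⟩
    0ℚ - (fold σ x i + - 1ℚ * z i)
      ≡⟨ solve 2 (λ f y → con 0ℚ :- (f :+ (:- con 1ℚ) :* y) := y :- f) refl (fold σ x i) (z i) ⟩
    z i - fold σ x i ∎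
    where
    open ≡-Reasoning
    δᵢ : Vector ℚ k
    δᵢ j = 𝟙 (i ≟ j)
    dot-δ : ∀ w → dot δᵢ w ≡ w i
    dot-δ w = trans (dot≡∑ δᵢ w) (∑-𝟙-δ i w)

  foldRow-Holds⇔ : ∀ x z i → Holds x z (foldRow i) ⇔ fold σ x i ≤ z i
  foldRow-Holds⇔ x z i = ⇔.trans (subst⇔ (0ℚ ≤_) (slack-foldRow x z i)) 0≤p-q⇔q≤p

  -foldRow-Holds⇔ : ∀ x z i → Holds x z (- 1ℚ ⊛ foldRow i) ⇔ z i ≤ fold σ x i
  -foldRow-Holds⇔ x z i = ⇔.trans (subst⇔ (0ℚ ≤_) (begin
    slack x z (- 1ℚ ⊛ foldRow i)      ≡⟨ slack-⊛ x z (- 1ℚ) (foldRow i) ⟩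
    - 1ℚ * slack x z (foldRow i)      ≡⟨ cong (- 1ℚ *_) (slack-foldRow x z i) ⟩
    - 1ℚ * (z i - fold σ x i)         ≡⟨ solve 2 (λ y f → (:- con 1ℚ) :* (y :- f) := f :- y) refl (z i) (fold σ x i) ⟩
    fold σ x i - z i                  ∎)) 0≤p-q⇔q≤p
    where open ≡-Reasoning

  fibreSystem-correct : ∀ x z → All (Holds x z) fibreSystem ⇔ (x ∈P P × fold σ x ≗ z)
  fibreSystem-correct x z = mk⇔
    (λ h → let (hA , hF) = ++⁻ (tabulate facetRow) h
               (h≤ , h≥) = ++⁻ (tabulate foldRow) hF
           in (λ j → to (facetRow-Holds⇔ x z j) (tabulate⁻ hA j))
            , (λ i → ≤-antisym (to (foldRow-Holds⇔ x z i) (tabulate⁻ h≤ i)) (to (-foldRow-Holds⇔ x z i) (tabulate⁻ h≥ i))))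
    (λ (x∈P , fold≗z) → ++⁺ (tabulate⁺ λ j → from (facetRow-Holds⇔ x z j) (x∈P j))
                       (++⁺ (tabulate⁺ λ i → from (foldRow-Holds⇔ x z i) (≤-reflexive (fold≗z i)))
                            (tabulate⁺ λ i → from (-foldRow-Holds⇔ x z i) (≤-reflexive (sym (fold≗z i))))))

  ∈Fold⇔projection : ∀ z → z ∈Fold[ σ ] P ⇔ All (Holds Vec.[] z) (project n fibreSystem)
  ∈Fold⇔projection z = ⇔.trans
    (mk⇔ (λ (x , x∈P , fold≗z) → x , from (fibreSystem-correct x z) (x∈P , fold≗z))
         (λ (x , h) → x , to (fibreSystem-correct x z) h))
    (project-correct n fibreSystem z)

  projection-holds : (∀ i → ∃ λ v → σ v ≡ i) → ∀ z → AllSepDisagree P σ (unfold σ z) →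
    All (Holds Vec.[] z) (project n fibreSystem)
  projection-holds onto z noSep = All.tabulate holds
    where
    valid : ∀ y → y ∈P P → All (Holds Vec.[] (fold σ y)) (project n fibreSystem)
    valid y y∈P = to (∈Fold⇔projection (fold σ y)) (y , y∈P , λ _ → refl)
    holds : ∀ {t} → t ∈ project n fibreSystem → Holds Vec.[] z t
    holds {t} t∈T with 0ℚ ≤? slack Vec.[] z t
    ... | yes h = h
    ... | no ¬h = ⊥-elim (noSep (foldᵀ σ (param t) , foldᵀ-agrees σ (param t) , separates))
      where
      separates : Separates (foldᵀ σ (param t)) P (unfold σ z)
      separates y y∈P = begin-strict
        dot (foldᵀ σ (param t)) y              ≡⟨ dot-fold σ (param t) y ⟨
        dot (param t) (fold σ y)               ≤⟨ to (Holds[]⇔ (fold σ y) t) (All.lookup (valid y y∈P) t∈T) ⟩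
        bound t                                <⟨ ≰⇒> (¬h ∘ from (Holds[]⇔ z t)) ⟩
        dot (param t) z                        ≡⟨ dot-congʳ (param t) (fold-unfold σ onto z) ⟨
        dot (param t) (fold σ (unfold σ z))    ≡⟨ dot-fold σ (param t) (unfold σ z) ⟩
        dot (foldᵀ σ (param t)) (unfold σ z)   ∎
        where open ≤-Reasoning

mainTheorem14 : (n k : ℕ) (P : Polytope n) (σ : Fin n → Fin k) → IsIndexMap n k σ →
    (z : Fin k → ℚ) → (z ∈Fold[ σ ] P) ⇔ ((unfold σ z ∈P P) ⊎ AllSepDisagree P σ (unfold σ z))
mainTheorem14 n k P σ (_ , onto) z = mk⇔ forward backward
  where
  forward : z ∈Fold[ σ ] P → (unfold σ z ∈P P) ⊎ AllSepDisagree P σ (unfold σ z)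
  forward (x , x∈P , fold≗z) = inj₂ λ (c , c~σ , c-separates) →
    <-irrefl (sym (dot-unfold σ onto c~σ fold≗z)) (c-separates x x∈P)
  backward : (unfold σ z ∈P P) ⊎ AllSepDisagree P σ (unfold σ z) → z ∈Fold[ σ ] P
  backward (inj₁ unfold∈P) = unfold σ z , unfold∈P , fold-unfold σ onto z
  backward (inj₂ noSep)    = from (∈Fold⇔projection P σ z) (projection-holds P σ onto z noSep)
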